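{- Let $n\ge 2$, let $p_1,\dots,p_l$ be distinct primes and $m_1,\dots,m_l\ge 2$ natural numbers. Suppose that for each $i\in\{1,\dots,l\}$, every nonnegative integer $b$, every natural $t$ and every $m$ with $2\le m\le m_i$ we have $P\big(\sum_{j=1}^m x_j^n=b\,(p_i^{t})^n\big)=P\big(\sum_{j=1}^m x_j^n=b\big)$. Then for every nonnegative integer $b$, all natural $n_1,\dots,n_l$ and every $m$ with $2\le m\le\min(m_1,\dots,m_l)$, $$P\Big(\sum_{j=1}^m x_j^n=b\,(p_1^{n_1}\cdots p_l^{n_l})^n\Big)=P\Big(\sum_{j=1}^m x_j^n=b\Big).$$
   Context: $P(f(x_1,\dots,x_m)=d)$ denotes the number of solutions $(x_1,\dots,x_m)$ in nonnegative integers. -}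

module Defs where

open import Data.Nat using (ℕ; zero; suc; _+_; _*_; _^_; _≟_)
open import Data.Fin using (Fin)
open import Data.List using (List; []; _∷_; map; concatMap; upTo; length; filter)
open import Data.Nat.ListAction using (sum)
open import Data.Vec using (Vec; []; _∷_; toList)
open import Relation.Binary.PropositionalEquality using (_≡_)

boxVecs : (m d : ℕ) → List (Vec ℕ m)
boxVecs zero    d = [] ∷ []
boxVecs (suc m) d = concatMap (λ x → map (x ∷_) (boxVecs m d)) (upTo (suc d))

powSum : {m : ℕ} → ℕ → Vec ℕ m → ℕ
powSum n v = sum (map (λ x → x ^ n) (toList v))

-- For n ≥ 1 every solution has x_j ≤ x_j^n ≤ d, so it suffices to
-- enumerate the box {0,…,d}^m (each vector listed exactly once).
P : (m n d : ℕ) → ℕ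
P m n d = length (filter (λ v → powSum n v ≟ d) (boxVecs m d))

prodFin : (l : ℕ) → (Fin l → ℕ) → ℕ
prodFin zero    f = 1
prodFin (suc l) f = f Fin.zero * prodFin l (λ i → f (Fin.suc i))

-- (∏ᵢ pᵢ^{nᵢ})ⁿ = ∏ᵢ (pᵢ^{nᵢ})ⁿ, and multiplying the target by any single
-- factor (pᵢ^{nᵢ})ⁿ leaves the count unchanged by hypothesis; multiplying by
-- the factors one at a time proves the claim.
module Submission where

open import Defs
open import Data.Nat using (ℕ; zero; suc; _*_; _^_; _≤_)
open import Data.Nat.Properties using (*-assoc; *-comm; *-identityʳ; ^-zeroˡ)
open import Data.Fin using (Fin)
open import Data.Nat.Primality using (Prime)
open import Function.Definitions using (Injective)
open import Relation.Binary.PropositionalEquality using (_≡_; refl; cong; sym; module ≡-Reasoning)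
open import Algebra.Properties.CommutativeSemigroup Data.Nat.Properties.*-commutativeSemigroup
  using (interchange)

^-distribʳ-* : ∀ m n o → (m * n) ^ o ≡ m ^ o * n ^ o
^-distribʳ-* m n zero    = refl
^-distribʳ-* m n (suc o) = begin
  m * n * (m * n) ^ o        ≡⟨ cong (m * n *_) (^-distribʳ-* m n o) ⟩
  m * n * (m ^ o * n ^ o)    ≡⟨ interchange m n (m ^ o) (n ^ o) ⟩
  m * m ^ o * (n * n ^ o)    ∎
  where open ≡-Reasoning

prodFin-^ : ∀ l (f : Fin l → ℕ) o → prodFin l f ^ o ≡ prodFin l (λ i → f i ^ o)
prodFin-^ zero    f o = ^-zeroˡ o
prodFin-^ (suc l) f o = begin
  (f Fin.zero * prodFin l (λ i → f (Fin.suc i))) ^ o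
    ≡⟨ ^-distribʳ-* (f Fin.zero) _ o ⟩
  f Fin.zero ^ o * prodFin l (λ i → f (Fin.suc i)) ^ o
    ≡⟨ cong (f Fin.zero ^ o *_) (prodFin-^ l (λ i → f (Fin.suc i)) o) ⟩
  f Fin.zero ^ o * prodFin l (λ i → f (Fin.suc i) ^ o) ∎
  where open ≡-Reasoning

*-prodFin-invariant : {A : Set} (g : ℕ → A) (l : ℕ) (c : Fin l → ℕ) →
  (∀ i b → g (b * c i) ≡ g b) → ∀ b → g (b * prodFin l c) ≡ g b
*-prodFin-invariant g zero    c inv b = cong g (*-identityʳ b)
*-prodFin-invariant g (suc l) c inv b = begin
  g (b * (c Fin.zero * rest))  ≡⟨ cong g (reorder b (c Fin.zero) rest) ⟩
  g (b * rest * c Fin.zero)    ≡⟨ inv Fin.zero (b * rest) ⟩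
  g (b * rest)                 ≡⟨ *-prodFin-invariant g l (λ i → c (Fin.suc i)) (λ i → inv (Fin.suc i)) b ⟩
  g b                          ∎
  where
  open ≡-Reasoning
  rest : ℕ
  rest = prodFin l (λ i → c (Fin.suc i))
  reorder : ∀ x y z → x * (y * z) ≡ x * z * y
  reorder x y z = begin
    x * (y * z)  ≡⟨ cong (x *_) (*-comm y z) ⟩
    x * (z * y)  ≡⟨ sym (*-assoc x z y) ⟩
    x * z * y    ∎

lemma2p4 : (n l : ℕ) → 2 ≤ n → 1 ≤ l →
    (p : Fin l → ℕ) → (∀ i → Prime (p i)) → Injective _≡_ _≡_ p →
    (ms : Fin l → ℕ) → (∀ i → 2 ≤ ms i) →
    (∀ i (b t m : ℕ) → 2 ≤ m → m ≤ ms i →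
      P m n (b * (p i ^ t) ^ n) ≡ P m n b) →
    ∀ (b : ℕ) (ns : Fin l → ℕ) (m : ℕ) → 2 ≤ m → (∀ i → m ≤ ms i) →
      P m n (b * (prodFin l (λ i → p i ^ ns i)) ^ n) ≡ P m n b
lemma2p4 n l _ _ p _ _ ms _ invariant b ns m 2≤m m≤ms = begin
  P m n (b * prodFin l q ^ n)
    ≡⟨ cong (λ x → P m n (b * x)) (prodFin-^ l q n) ⟩
  P m n (b * prodFin l (λ i → q i ^ n))
    ≡⟨ *-prodFin-invariant (P m n) l (λ i → q i ^ n)
         (λ i b′ → invariant i b′ (ns i) m 2≤m (m≤ms i)) b ⟩
  P m n b ∎
  where
  open ≡-Reasoning
  q : Fin l → ℕ
  q i = p i ^ ns i
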